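{- Every inclusion-maximal set of pairwise non-crossing edges of $G^{\varepsilon}_{I_\bullet,J_\circ}$ is (the edge set of) a spanning tree of $G^{\varepsilon}_{I_\bullet,J_\circ}$.
   Context: Fix an integer $n\ge 1$ and a signature $\varepsilon=(\varepsilon_1,\dots,\varepsilon_n)\in\{+,-\}^n$. Black vertices are labelled $0_\bullet,\dots,n_\bullet$ and white vertices $1_\circ,\dots,(n+1)_\circ$; black and white vertices are compared through their integer indices (e.g. $i_\bullet<j_\circ$ means $i<j$). Let $P_\varepsilon$ be a convex $(2n+2)$-gon in $\mathbb{R}^2$ whose vertices, in strictly increasing order of $x$-coordinate, are $0_\bullet,1_\circ,1_\bullet,2_\circ,2_\bullet,\dots,n_\circ,n_\bullet,(n+1)_\circ$, where for each $k\in\{1,\dots,n\}$ both $k_\circ$ and $k_\bullet$ lie strictly above the line through $0_\bullet$ and $(n+1)_\circ$ if $\varepsilon_k=+$ and strictly below it if $\varepsilon_k=-$. Let $I_\bullet\subseteq\{0_\bullet,\dots,n_\bullet\}$ and $J_\circ\subseteq\{1_\circ,\dots,(n+1)_\circ\}$ be nonempty with $\min(I_\bullet)<\min(J_\circ)$ and $\max(I_\bullet)<\max(J_\circ)$. Let $G^{\varepsilon}_{I_\bullet,J_\circ}$ be the geometric graph with vertex set $I_\bullet\cup J_\circ$ (as points of $P_\varepsilon$) and with an edge $(i_\bullet,j_\circ)$, drawn as a straight segment, between $i_\bullet\in I_\bullet$ and $j_\circ\in J_\circ$ whenever $i<j$. Two edges cross if they meet at a point lying in the relative interior of both segments. -}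

module Defs where

open import Data.Nat using (ℕ; zero; suc; _+_; _*_; _∸_; _<_; _≤_)
open import Data.Fin using (Fin; zero; suc; toℕ)
open import Data.Fin.Subset using (Subset; _∈_)
open import Data.Bool using (Bool; true; false; if_then_else_)
open import Data.List using (List; []; _∷_; _++_; [_]; length)
open import Data.List.Relation.Unary.Unique.Propositional using (Unique)
open import Data.Product using (_×_; Σ; ∃; ∃-syntax; _,_)
open import Data.Sum using (_⊎_)
open import Data.Empty using (⊥)
open import Data.Unit using (⊤)
open import Relation.Nullary using (¬_)
open import Relation.Binary.PropositionalEquality using (_≡_; _≢_)

data Sign : Set where
  plus minus : Sign

-- Vertices of P_ε.
-- black i  (i : Fin (suc n))  is the black vertex  i_•   (index toℕ i ∈ {0..n})
-- white j  (j : Fin (suc n))  is the white vertex (j+1)_∘ (index toℕ j + 1 ∈ {1..n+1})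

data Vtx (n : ℕ) : Set where
  black : Fin (suc n) → Vtx n
  white : Fin (suc n) → Vtx n

blackIdx : ∀ {n} → Fin (suc n) → ℕ
blackIdx i = toℕ i

whiteIdx : ∀ {n} → Fin (suc n) → ℕ
whiteIdx j = suc (toℕ j)

-- Position in the left-to-right (increasing x-coordinate) order
-- 0_•, 1_∘, 1_•, 2_∘, ..., n_•, (n+1)_∘  (positions 0 .. 2n+1).
xpos : ∀ {n} → Vtx n → ℕ
xpos (black i) = 2 * toℕ i
xpos (white j) = suc (2 * toℕ j)

-- Is the vertex strictly above the line through 0_• and (n+1)_∘ ?
-- black 0_• and white (n+1)_∘ lie on the line; k_• and k_∘ (1 ≤ k ≤ n)
-- are above iff ε_k = +  (ε is indexed by Fin n, ε_k = ε (k-1)).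
isPlus : Sign → Bool
isPlus plus  = true
isPlus minus = false

blackAbove : ∀ {n} → (Fin n → Sign) → Fin (suc n) → Bool
blackAbove ε zero    = false
blackAbove ε (suc i) = isPlus (ε i)

whiteAbove : ∀ {n} → (Fin n → Sign) → Fin (suc n) → Bool
whiteAbove {zero}  ε zero    = false
whiteAbove {suc n} ε zero    = isPlus (ε zero)
whiteAbove {suc n} ε (suc j) = whiteAbove {n} (λ k → ε (suc k)) j

above : ∀ {n} → (Fin n → Sign) → Vtx n → Bool
above ε (black i) = blackAbove ε i
above ε (white j) = whiteAbove ε j

-- Rank of a vertex in the (counterclockwise) cyclic order of the boundary
-- of the convex polygon P_ε: starting at 0_•, the vertices on or below the
-- line in increasing x-order (ending with (n+1)_∘), then the vertices above
-- the line in decreasing x-order.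
cyc : ∀ {n} → (Fin n → Sign) → Vtx n → ℕ
cyc {n} ε v = if above ε v then (4 * n + 3) ∸ xpos v else xpos v

Between : ℕ → ℕ → ℕ → Set
Between a b x = (a < x × x < b) ⊎ (b < x × x < a)

-- Two straight segments between vertices of a (strictly) convex polygon
-- meet in a point interior to both iff their four endpoints are distinct
-- and interleave in the cyclic boundary order.
Cross : ∀ {n} → (Fin n → Sign) →
        Fin (suc n) → Fin (suc n) → Fin (suc n) → Fin (suc n) → Set
Cross ε i j i' j' =
  i ≢ i' × j ≢ j' ×
  ( (Between a b c × ¬ Between a b d) ⊎ (¬ Between a b c × Between a b d) )
  where
  a = cyc ε (black i)
  b = cyc ε (white j)
  c = cyc ε (black i')
  d = cyc ε (white j')

-- The graph G^ε_{I,J}.  I, J : Subset (suc n); I contains black i iff i ∈ I,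
-- J contains white (j+1)_∘ iff j ∈ J.

IsEdge : ∀ {n} → Subset (suc n) → Subset (suc n) → Fin (suc n) → Fin (suc n) → Set
IsEdge I J i j = i ∈ I × j ∈ J × blackIdx i < whiteIdx j

-- Sets of edges: S i j ≡ true means the edge (i_•, (j+1)_∘) is in S.
EdgeSet : ℕ → Set
EdgeSet n = Fin (suc n) → Fin (suc n) → Bool

_⊆E_ : ∀ {n} → EdgeSet n → EdgeSet n → Set
S ⊆E T = ∀ i j → S i j ≡ true → T i j ≡ true

EdgesOf : ∀ {n} → Subset (suc n) → Subset (suc n) → EdgeSet n → Set
EdgesOf I J S = ∀ i j → S i j ≡ true → IsEdge I J i j

NonCrossing : ∀ {n} → (Fin n → Sign) → EdgeSet n → Set
NonCrossing ε S = ∀ i j i' j' → S i j ≡ true → S i' j' ≡ true → ¬ Cross ε i j i' j'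

MaximalNonCrossing : ∀ {n} → (Fin n → Sign) → Subset (suc n) → Subset (suc n) →
                     EdgeSet n → Set
MaximalNonCrossing ε I J S =
  EdgesOf I J S × NonCrossing ε S ×
  (∀ T → EdgesOf I J T → NonCrossing ε T → S ⊆E T → T ⊆E S)

InV : ∀ {n} → Subset (suc n) → Subset (suc n) → Vtx n → Set
InV I J (black i) = i ∈ I
InV I J (white j) = j ∈ J

Adj : ∀ {n} → EdgeSet n → Vtx n → Vtx n → Set
Adj S (black i) (white j) = S i j ≡ true
Adj S (white j) (black i) = S i j ≡ true
Adj S (black _) (black _) = ⊥
Adj S (white _) (white _) = ⊥

data Walk {n} (S : EdgeSet n) : Vtx n → Vtx n → Set where
  here : ∀ {v} → Walk S v v
  step : ∀ {u v w} → Adj S u v → Walk S v w → Walk S u w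

Chain : ∀ {n} → EdgeSet n → List (Vtx n) → Set
Chain S []           = ⊤
Chain S (u ∷ [])     = ⊤
Chain S (u ∷ v ∷ vs) = Adj S u v × Chain S (v ∷ vs)

IsCycle : ∀ {n} → EdgeSet n → List (Vtx n) → Set
IsCycle S [] = ⊥
IsCycle S (v ∷ vs) = 3 ≤ length (v ∷ vs) × Unique (v ∷ vs) × Chain S ((v ∷ vs) ++ [ v ])

IsSpanningTree : ∀ {n} → Subset (suc n) → Subset (suc n) → EdgeSet n → Set
IsSpanningTree {n} I J S =
  EdgesOf I J S ×
  (∀ u v → InV I J u → InV I J v → Walk S u v) ×
  (∀ (cs : List (Vtx n)) → ¬ IsCycle S cs)

-- Two chords of the convex polygon P_ε cross iff their endpoints interleave in the
-- boundary order cyc ε, so every fact about crossings used below is either a statement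
-- about the order of at most six boundary positions, settled by checking all their order
-- patterns, or a computation of that order from the x-order and the sides of the line
-- through 0• and (n+1)∘ on which the vertices lie.
--
-- Connectivity: an edge (i, j) of G missing from the maximal non-crossing set S is crossed by
-- some edge (a, b) of S; then (i, b) and (a, j) are edges of G, and every edge of S crossing
-- one of them also crosses (i, j) (it cannot cross (a, b)), while (a, b) crosses neither. By
-- induction on the number of crossing edges of S, the endpoints of every edge of G are joined
-- in S, and the conditions on min and max join every vertex to one white vertex by such edges.
--
-- Acyclicity: on a cycle of S let k be the black vertex of largest index, j and j′ its two
-- white neighbours with j < j′, and ia, ic the other neighbours of j and j′. Then
-- ia, ic < k ≤ j < j′, and this configuration forces (ia, j) to cross (k, j′) or (ic, j′)
-- to cross (k, j).

module Submission where

open import Defs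
open import Data.Nat using (ℕ; suc; _+_; _<_; _≤_)
open import Data.Fin using (Fin)
open import Data.Fin.Subset using (Subset; _∈_)
open import Data.Product using (_×_; ∃-syntax)

open import Data.Bool using (Bool; true; false; not; _∧_; _∨_; _xor_; if_then_else_)
import Data.Bool.Properties as Bool
open import Data.Nat using (zero; _∸_; _*_; _<?_; z≤n; s≤s; s≤s⁻¹)
import Data.Nat.Properties as ℕ
open import Data.Nat.Properties
  using ( ≤-reflexive; ≤-trans; <-trans; <-≤-trans; ≤-<-trans
        ; <⇒≤; <⇒≯; <⇒≱; <⇒≢; ≰⇒>; ≮⇒≥
        ; <-irrefl; ≤-antisym; ≤∧≢⇒<; <-cmp; m≤n⇒m≤1+n; m≤m+n; suc-injective; +-comm
        ; *-monoʳ-≤; *-monoʳ-<; *-suc; *-cancelˡ-≡; even≢odd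
        ; ∸-monoʳ-≤; ∸-monoʳ-<; ∸-cancelˡ-≡; m+n≤o⇒m≤o∸n; allUpTo? )
open import Data.Nat.Induction using (<-wellFounded)
open import Data.Nat.Tactic.RingSolver using (solve-∀)
open import Data.Fin using (zero; suc; toℕ; #_; _≟_)
open import Data.Fin.Properties using (toℕ-injective; toℕ≤pred[n]; any?)
import Data.Fin.Properties as Fin
open import Data.Vec using (Vec; []; _∷_; lookup; map; count; allFin; allPairs)
open import Data.Vec.Properties using (lookup-map; count≤n)
open import Data.Vec.Membership.Propositional using () renaming (_∈_ to _∈ᵛ_)
open import Data.Vec.Membership.Propositional.Properties using (∈-lookup; ∈-allFin⁺; ∈-allPairs⁺)
import Data.Vec.Relation.Unary.Any as VecAny
open import Data.List using (List; []; _∷_; _++_; [_]; _∷ʳ_; length)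
open import Data.List.Properties using (++-assoc; ++-identityʳ; length-++)
open import Data.List.Membership.Propositional using () renaming (_∈_ to _∈ˡ_)
open import Data.List.Membership.Propositional.Properties using (∈-∃++; ∈-++⁺ʳ)
open import Data.List.Relation.Unary.Any using (here; there)
open import Data.List.Relation.Unary.All using (All; []; _∷_)
import Data.List.Relation.Unary.All as All
import Data.List.Relation.Unary.All.Properties as All
open import Data.List.Relation.Unary.AllPairs using ([]; _∷_)
open import Data.List.Relation.Unary.Unique.Propositional using (Unique)
import Data.List.Relation.Unary.Unique.Propositional.Properties as Unique
open import Data.List.Extrema.Nat using (argmax; argmax-sel; f[⊥]≤f[argmax]; f[xs]≤f[argmax])
open import Data.Product using (_,_; proj₁; proj₂; uncurry)
open import Data.Product.Function.NonDependent.Propositional using (_×-⇔_)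
open import Data.Sum using (_⊎_; inj₁; inj₂; [_,_]′)
open import Data.Sum.Function.Propositional using (_⊎-⇔_)
open import Data.Unit using (tt)
open import Data.Empty using (⊥)
open import Function using (_∘_; _⇔_; mk⇔; Equivalence)
import Function.Properties.Equivalence as ⇔
open import Function.Related.TypeIsomorphisms using (→-cong-⇔; ¬-cong-⇔)
open import Induction.WellFounded using (Acc; acc)
open import Relation.Nullary using (¬_; Dec; yes; no; does; contradiction)
open import Relation.Nullary.Decidable
  using (True; toWitness; dec-true; dec-false; _×-dec_; _⊎-dec_; _→-dec_; ¬?; map′)
open import Relation.Unary using (Pred; Decidable)
open import Relation.Binary.Definitions using (Tri; tri<; tri≈; tri>)
open import Relation.Binary.PropositionalEquality
  using (_≡_; _≢_; refl; sym; trans; cong; subst; module ≡-Reasoning)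

module _ {a p q} {A : Set a} {P : Pred A p} {Q : Pred A q} (P? : Decidable P) (Q? : Decidable Q) where

  count-mono : ∀ {n} → (∀ {x} → P x → Q x) → (xs : Vec A n) → count P? xs ≤ count Q? xs
  count-mono P⇒Q [] = z≤n
  count-mono P⇒Q (x ∷ xs) with P? x | Q? x
  ... | yes _  | yes _  = s≤s (count-mono P⇒Q xs)
  ... | yes px | no ¬qx = contradiction (P⇒Q px) ¬qx
  ... | no _   | yes _  = m≤n⇒m≤1+n (count-mono P⇒Q xs)
  ... | no _   | no _   = count-mono P⇒Q xs

  count-strict : ∀ {n x} {xs : Vec A n} → (∀ {x} → P x → Q x) → x ∈ᵛ xs → ¬ P x → Q x →
                 count P? xs < count Q? xs
  count-strict {xs = y ∷ xs} P⇒Q (VecAny.here refl) ¬py qy with P? y | Q? y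
  ... | yes py | _      = contradiction py ¬py
  ... | no _   | no ¬qy = contradiction qy ¬qy
  ... | no _   | yes _  = s≤s (count-mono P⇒Q xs)
  count-strict {xs = y ∷ xs} P⇒Q (VecAny.there x∈xs) ¬px qx with P? y | Q? y
  ... | yes _  | yes _  = s≤s (count-strict P⇒Q x∈xs ¬px qx)
  ... | yes py | no ¬qy = contradiction (P⇒Q py) ¬qy
  ... | no _   | yes _  = s≤s (<⇒≤ (count-strict P⇒Q x∈xs ¬px qx))
  ... | no _   | no _   = count-strict P⇒Q x∈xs ¬px qx

module _ {a p} {A : Set a} {P : Pred A p} (P? : Decidable P) where

  count-<-length : ∀ {n x} {xs : Vec A n} → x ∈ᵛ xs → ¬ P x → count P? xs < n
  count-<-length {xs = y ∷ xs} (VecAny.here refl) ¬py with P? y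
  ... | yes py = contradiction py ¬py
  ... | no _   = s≤s (count≤n P? xs)
  count-<-length {xs = y ∷ xs} (VecAny.there x∈xs) ¬px with P? y
  ... | yes _ = s≤s (count-<-length x∈xs ¬px)
  ... | no _  = m≤n⇒m≤1+n (count-<-length x∈xs ¬px)

infix  7 _≺_ _≐_
infixr 6 ¬ᶠ_
infixr 5 _∧ᶠ_
infixr 4 _∨ᶠ_
infixr 3 _⇒ᶠ_

data OrderFormula (k : ℕ) : Set where
  _≺_ _≐_        : Fin k → Fin k → OrderFormula k
  ¬ᶠ_            : OrderFormula k → OrderFormula k
  _∧ᶠ_ _∨ᶠ_ _⇒ᶠ_ : OrderFormula k → OrderFormula k → OrderFormula k

⟦_⟧ : ∀ {k} → OrderFormula k → Vec ℕ k → Set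
⟦ u ≺ v ⟧ ρ = lookup ρ u < lookup ρ v
⟦ u ≐ v ⟧ ρ = lookup ρ u ≡ lookup ρ v
⟦ ¬ᶠ φ ⟧ ρ = ¬ ⟦ φ ⟧ ρ
⟦ φ ∧ᶠ ψ ⟧ ρ = ⟦ φ ⟧ ρ × ⟦ ψ ⟧ ρ
⟦ φ ∨ᶠ ψ ⟧ ρ = ⟦ φ ⟧ ρ ⊎ ⟦ ψ ⟧ ρ
⟦ φ ⇒ᶠ ψ ⟧ ρ = ⟦ φ ⟧ ρ → ⟦ ψ ⟧ ρ

⟦_⟧? : ∀ {k} (φ : OrderFormula k) → Decidable ⟦ φ ⟧
⟦ u ≺ v ⟧? ρ = lookup ρ u <? lookup ρ v
⟦ u ≐ v ⟧? ρ = lookup ρ u ℕ.≟ lookup ρ v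
⟦ ¬ᶠ φ ⟧? ρ = ¬? (⟦ φ ⟧? ρ)
⟦ φ ∧ᶠ ψ ⟧? ρ = ⟦ φ ⟧? ρ ×-dec ⟦ ψ ⟧? ρ
⟦ φ ∨ᶠ ψ ⟧? ρ = ⟦ φ ⟧? ρ ⊎-dec ⟦ ψ ⟧? ρ
⟦ φ ⇒ᶠ ψ ⟧? ρ = ⟦ φ ⟧? ρ →-dec ⟦ ψ ⟧? ρ

_≅_ : ∀ {k} → Vec ℕ k → Vec ℕ k → Set
ρ ≅ σ = ∀ u v → lookup ρ u < lookup ρ v ⇔ lookup σ u < lookup σ v

≡⇔≮∧≯ : ∀ {x y} → x ≡ y ⇔ (¬ x < y × ¬ y < x)
≡⇔≮∧≯ = mk⇔ (λ { refl → <-irrefl refl , <-irrefl refl })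
            (λ (x≮y , y≮x) → ≤-antisym (≮⇒≥ y≮x) (≮⇒≥ x≮y))

⟦⟧-cong : ∀ {k} {ρ σ : Vec ℕ k} → ρ ≅ σ → ∀ φ → ⟦ φ ⟧ ρ ⇔ ⟦ φ ⟧ σ
⟦⟧-cong ρ≅σ (u ≺ v)  = ρ≅σ u v
⟦⟧-cong ρ≅σ (u ≐ v)  =
  ⇔.trans ≡⇔≮∧≯ (⇔.trans (¬-cong-⇔ (ρ≅σ u v) ×-⇔ ¬-cong-⇔ (ρ≅σ v u)) (⇔.sym ≡⇔≮∧≯))
⟦⟧-cong ρ≅σ (¬ᶠ φ)   = ¬-cong-⇔ (⟦⟧-cong ρ≅σ φ)
⟦⟧-cong ρ≅σ (φ ∧ᶠ ψ) = ⟦⟧-cong ρ≅σ φ ×-⇔ ⟦⟧-cong ρ≅σ ψ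
⟦⟧-cong ρ≅σ (φ ∨ᶠ ψ) = ⟦⟧-cong ρ≅σ φ ⊎-⇔ ⟦⟧-cong ρ≅σ ψ
⟦⟧-cong ρ≅σ (φ ⇒ᶠ ψ) = →-cong-⇔ (⟦⟧-cong ρ≅σ φ) (⟦⟧-cong ρ≅σ ψ)

-- Replacing every value by the number of smaller values preserves the relative order and
-- bounds all values by k, so validity of an order formula is decided by a finite search.
rank : ∀ {k} → Vec ℕ k → ℕ → ℕ
rank ρ x = count (_<? x) ρ

ranks : ∀ {k} → Vec ℕ k → Vec ℕ k
ranks ρ = map (rank ρ) ρ

rank-<-⇔ : ∀ {k} {ρ : Vec ℕ k} {x y} → x ∈ᵛ ρ → x < y ⇔ rank ρ x < rank ρ y
rank-<-⇔ {ρ = ρ} {x} {y} x∈ρ = mk⇔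
  (λ x<y → count-strict (_<? x) (_<? y) (λ z<x → <-trans z<x x<y) x∈ρ (<-irrefl refl) x<y)
  (λ rx<ry → ≰⇒> λ y≤x → <⇒≱ rx<ry (count-mono (_<? y) (_<? x) (λ z<y → <-≤-trans z<y y≤x) ρ))

ranks-≅ : ∀ {k} (ρ : Vec ℕ k) → ρ ≅ ranks ρ
ranks-≅ ρ u v rewrite lookup-map u (rank ρ) ρ | lookup-map v (rank ρ) ρ = rank-<-⇔ (∈-lookup u ρ)

Bounded : ∀ {k} → ℕ → Vec ℕ k → Set
Bounded m ρ = ∀ u → lookup ρ u < m

ranks-bounded : ∀ {k} (ρ : Vec ℕ k) → Bounded k (ranks ρ)
ranks-bounded ρ u rewrite lookup-map u (rank ρ) ρ =
  count-<-length (_<? lookup ρ u) (∈-lookup u ρ) (<-irrefl refl)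

∀-bounded? : ∀ {k p} m {P : Pred (Vec ℕ k) p} → Decidable P → Dec (∀ ρ → Bounded m ρ → P ρ)
∀-bounded? {zero}  m {P} P? = map′ (λ P[] → λ { [] _ → P[] }) (λ ∀P → ∀P [] λ ()) (P? [])
∀-bounded? {suc k} m {P} P? = map′ to from (allUpTo? (λ x → ∀-bounded? m (P? ∘ (x ∷_))) m)
  where
  to : (∀ {x} → x < m → ∀ ρ → Bounded m ρ → P (x ∷ ρ)) → ∀ ρ → Bounded m ρ → P ρ
  to ∀P (x ∷ ρ) bnd = ∀P (bnd zero) ρ (bnd ∘ suc)
  from : (∀ ρ → Bounded m ρ → P ρ) → ∀ {x} → x < m → ∀ ρ → Bounded m ρ → P (x ∷ ρ)
  from ∀P x<m ρ bnd = ∀P _ λ { zero → x<m ; (suc u) → bnd u }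

valid-by-ranks : ∀ {k} (φ : OrderFormula k) →
                 (∀ ρ → Bounded k ρ → ⟦ φ ⟧ ρ) → ∀ ρ → ⟦ φ ⟧ ρ
valid-by-ranks φ valid ρ =
  Equivalence.from (⟦⟧-cong (ranks-≅ ρ) φ) (valid (ranks ρ) (ranks-bounded ρ))

decide : ∀ {k} (φ : OrderFormula k) {_ : True (∀-bounded? k ⟦ φ ⟧?)} → ∀ ρ → ⟦ φ ⟧ ρ
decide φ {valid} = valid-by-ranks φ (toWitness valid)

between? : ∀ a b x → Dec (Between a b x)
between? a b x = (a <? x ×-dec x <? b) ⊎-dec (b <? x ×-dec x <? a)

Separates : ℕ → ℕ → ℕ → ℕ → Set
Separates a b c d = (Between a b c × ¬ Between a b d) ⊎ (¬ Between a b c × Between a b d)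

separates? : ∀ a b c d → Dec (Separates a b c d)
separates? a b c d = (between? a b c ×-dec ¬? (between? a b d)) ⊎-dec (¬? (between? a b c) ×-dec between? a b d)

Crossing : ℕ → ℕ → ℕ → ℕ → Set
Crossing a b c d = a ≢ c × b ≢ d × Separates a b c d

opposite-sides⇒separates : ∀ {a b c d} →
  does (between? a b c) ≡ not (does (between? a b d)) → Separates a b c d
opposite-sides⇒separates {a} {b} {c} {d} = exactly-one (between? a b c) (between? a b d)
  where
  exactly-one : ∀ {C D : Set} (C? : Dec C) (D? : Dec D) →
                does C? ≡ not (does D?) → (C × ¬ D) ⊎ (¬ C × D)
  exactly-one (yes c) (no ¬d) _ = inj₁ (c , ¬d)
  exactly-one (no ¬c) (yes d) _ = inj₂ (¬c , d)
  exactly-one (yes _) (yes _) ()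
  exactly-one (no _)  (no _)  ()

same-side⇒¬separates : ∀ {a b c d} →
  does (between? a b c) ≡ does (between? a b d) → ¬ Separates a b c d
same-side⇒¬separates {a} {b} {c} {d} = neither (between? a b c) (between? a b d)
  where
  neither : ∀ {C D : Set} (C? : Dec C) (D? : Dec D) →
            does C? ≡ does D? → ¬ ((C × ¬ D) ⊎ (¬ C × D))
  neither (yes _) (yes d) _ (inj₁ (_ , ¬d)) = ¬d d
  neither (yes c) (yes _) _ (inj₂ (¬c , _)) = ¬c c
  neither (no _)  (no ¬d) _ (inj₂ (_ , d))  = ¬d d
  neither (no ¬c) (no _)  _ (inj₁ (c , _))  = ¬c c
  neither (yes _) (no _)  ()
  neither (no _)  (yes _) ()

betweenᶠ : ∀ {k} → Fin k → Fin k → Fin k → OrderFormula k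
betweenᶠ a b x = (a ≺ x ∧ᶠ x ≺ b) ∨ᶠ (b ≺ x ∧ᶠ x ≺ a)

crossingᶠ : ∀ {k} → Fin k → Fin k → Fin k → Fin k → OrderFormula k
crossingᶠ a b c d = ¬ᶠ a ≐ c ∧ᶠ ¬ᶠ b ≐ d ∧ᶠ
  ((betweenᶠ a b c ∧ᶠ ¬ᶠ betweenᶠ a b d) ∨ᶠ (¬ᶠ betweenᶠ a b c ∧ᶠ betweenᶠ a b d))

-- In a chord ab, a is the position of a black and b that of a white vertex; the hypotheses
-- a ≢ y, … say that a black and a white vertex never share a position. If ab and cd cross at
-- a point X, a chord that crosses the side ad of the triangle aXd (or the side cb of cXb)
-- but not cd leaves the triangle through ab.
crossing-sym : ∀ {a b c d} → a ≢ d → c ≢ b → Crossing a b c d → Crossing c d a b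
crossing-sym {a} {b} {c} {d} =
  decide (¬ᶠ # 0 ≐ # 3 ⇒ᶠ ¬ᶠ # 2 ≐ # 1 ⇒ᶠ
          crossingᶠ (# 0) (# 1) (# 2) (# 3) ⇒ᶠ crossingᶠ (# 2) (# 3) (# 0) (# 1))
         (a ∷ b ∷ c ∷ d ∷ [])

crossing-swap-white : ∀ {a b c d x y} → a ≢ y → c ≢ y → x ≢ d →
  Crossing a b c d → Crossing a d x y → ¬ Crossing c d x y → Crossing a b x y
crossing-swap-white {a} {b} {c} {d} {x} {y} =
  decide (¬ᶠ # 0 ≐ # 5 ⇒ᶠ ¬ᶠ # 2 ≐ # 5 ⇒ᶠ ¬ᶠ # 4 ≐ # 3 ⇒ᶠ
          crossingᶠ (# 0) (# 1) (# 2) (# 3) ⇒ᶠ crossingᶠ (# 0) (# 3) (# 4) (# 5) ⇒ᶠ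
          ¬ᶠ crossingᶠ (# 2) (# 3) (# 4) (# 5) ⇒ᶠ crossingᶠ (# 0) (# 1) (# 4) (# 5))
         (a ∷ b ∷ c ∷ d ∷ x ∷ y ∷ [])

crossing-swap-black : ∀ {a b c d x y} → c ≢ y → x ≢ b → x ≢ d →
  Crossing a b c d → Crossing c b x y → ¬ Crossing c d x y → Crossing a b x y
crossing-swap-black {a} {b} {c} {d} {x} {y} =
  decide (¬ᶠ # 2 ≐ # 5 ⇒ᶠ ¬ᶠ # 4 ≐ # 1 ⇒ᶠ ¬ᶠ # 4 ≐ # 3 ⇒ᶠ
          crossingᶠ (# 0) (# 1) (# 2) (# 3) ⇒ᶠ crossingᶠ (# 2) (# 1) (# 4) (# 5) ⇒ᶠ
          ¬ᶠ crossingᶠ (# 2) (# 3) (# 4) (# 5) ⇒ᶠ crossingᶠ (# 0) (# 1) (# 4) (# 5))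
         (a ∷ b ∷ c ∷ d ∷ x ∷ y ∷ [])

module BoundaryOrder (K L : ℕ) (L+L<K : L + L < K) where

  -- cyc ε v ≡ fold (above ε v) (xpos v) for K = 4n+3 and L = 2n+1: the boundary passes the
  -- vertices below the line from left to right and then those above it from right to left.
  fold : Bool → ℕ → ℕ
  fold a x = if a then K ∸ x else x

  private
    ≤L⇒≤K : ∀ {x} → x ≤ L → x ≤ K
    ≤L⇒≤K x≤L = ≤-trans x≤L (<⇒≤ (≤-<-trans (m≤m+n L L) L+L<K))

    <≤L⇒≤L : ∀ {x y} → x < y → y ≤ L → x ≤ L
    <≤L⇒≤L x<y y≤L = ≤-trans (<⇒≤ x<y) y≤L

    below<above : ∀ {x y} → x ≤ L → y ≤ L → x < K ∸ y
    below<above x≤L y≤L =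
      ≤-<-trans x≤L (<-≤-trans (m+n≤o⇒m≤o∸n (suc L) L+L<K) (∸-monoʳ-≤ K y≤L))

  fold-left<right : ∀ {a b x y} → x < y → y ≤ L → does (fold a x <? fold b y) ≡ not a
  fold-left<right {false} {false} x<y y≤L = dec-true (_ <? _) x<y
  fold-left<right {false} {true}  x<y y≤L = dec-true (_ <? _) (below<above (<≤L⇒≤L x<y y≤L) y≤L)
  fold-left<right {true}  {false} x<y y≤L = dec-false (_ <? _) (<⇒≯ (below<above y≤L (<≤L⇒≤L x<y y≤L)))
  fold-left<right {true}  {true}  x<y y≤L = dec-false (_ <? _) (<⇒≯ (∸-monoʳ-< x<y (≤L⇒≤K y≤L)))

  fold-right<left : ∀ {a b x y} → x < y → y ≤ L → does (fold b y <? fold a x) ≡ a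
  fold-right<left {false} {false} x<y y≤L = dec-false (_ <? _) (<⇒≯ x<y)
  fold-right<left {false} {true}  x<y y≤L = dec-false (_ <? _) (<⇒≯ (below<above (<≤L⇒≤L x<y y≤L) y≤L))
  fold-right<left {true}  {false} x<y y≤L = dec-true (_ <? _) (below<above y≤L (<≤L⇒≤L x<y y≤L))
  fold-right<left {true}  {true}  x<y y≤L = dec-true (_ <? _) (∸-monoʳ-< x<y (≤L⇒≤K y≤L))

  fold-injective : ∀ {a b x y} → x ≤ L → y ≤ L → fold a x ≡ fold b y → x ≡ y
  fold-injective {false} {false} _   _   x≡y = x≡y
  fold-injective {false} {true}  x≤L y≤L x≡K∸y = contradiction x≡K∸y (<⇒≢ (below<above x≤L y≤L))
  fold-injective {true}  {false} x≤L y≤L K∸x≡y = contradiction (sym K∸x≡y) (<⇒≢ (below<above y≤L x≤L))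
  fold-injective {true}  {true}  x≤L y≤L K∸x≡K∸y =
    ∸-cancelˡ-≡ (≤L⇒≤K x≤L) (≤L⇒≤K y≤L) K∸x≡K∸y

  between-middle : ∀ {a b c x y z} → x < z → z < y → y ≤ L →
                   does (between? (fold a x) (fold b y) (fold c z)) ≡ not (a xor c)
  between-middle {a} {b} {c} x<z z<y y≤L
    rewrite fold-left<right {a} {c} x<z (<≤L⇒≤L z<y y≤L) | fold-right<left {a} {c} x<z (<≤L⇒≤L z<y y≤L)
          | fold-left<right {c} {b} z<y y≤L | fold-right<left {c} {b} z<y y≤L = table a c
    where
    table : ∀ a c → (not a ∧ not c) ∨ (c ∧ a) ≡ not (a xor c)
    table false false = refl
    table false true  = refl
    table true  false = refl
    table true  true  = refl

  between-right : ∀ {a b c x y z} → x < y → y < z → z ≤ L →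
                  does (between? (fold a x) (fold b y) (fold c z)) ≡ a xor b
  between-right {a} {b} {c} x<y y<z z≤L
    rewrite fold-left<right {a} {c} (<-trans x<y y<z) z≤L | fold-right<left {a} {c} (<-trans x<y y<z) z≤L
          | fold-left<right {b} {c} y<z z≤L | fold-right<left {b} {c} y<z z≤L = table a b
    where
    table : ∀ a b → (not a ∧ b) ∨ (not b ∧ a) ≡ a xor b
    table false false = refl
    table false true  = refl
    table true  false = refl
    table true  true  = refl

  between-left : ∀ {a b c x y z} → z < x → x < y → y ≤ L →
                 does (between? (fold a x) (fold b y) (fold c z)) ≡ false
  between-left {a} {b} {c} z<x x<y y≤L
    rewrite fold-left<right {c} {a} z<x (<≤L⇒≤L x<y y≤L) | fold-right<left {c} {a} z<x (<≤L⇒≤L x<y y≤L)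
          | fold-left<right {c} {b} (<-trans z<x x<y) y≤L | fold-right<left {c} {b} (<-trans z<x x<y) y≤L
          | Bool.∧-inverseʳ c = refl

last-two : ∀ {a} {A : Set a} (xs : List A) → 2 ≤ length xs →
           ∃[ ps ] ∃[ x ] ∃[ y ] xs ≡ ps ++ x ∷ y ∷ []
last-two (_ ∷ [])         (s≤s ())
last-two (x ∷ y ∷ [])     _ = [] , x , y , refl
last-two (x ∷ y ∷ z ∷ xs) _ with last-two (y ∷ z ∷ xs) (s≤s (s≤s z≤n))
... | ps , x′ , y′ , eq = x ∷ ps , x′ , y′ , cong (x ∷_) eq

All-rotate : ∀ {a p} {A : Set a} {P : Pred A p} xs {v ys} → All P (xs ++ v ∷ ys) → All P (v ∷ ys ++ xs)
All-rotate xs all with All.++⁻ xs all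
... | pxs , pv ∷ pys = pv ∷ All.++⁺ pys pxs

height : ∀ {n} → Vtx n → ℕ
height (black i) = suc (toℕ i)
height (white _) = 0

highest-black : ∀ {n} {i} (vs : List (Vtx n)) → black i ∈ˡ vs →
                ∃[ k ] black k ∈ˡ vs × All (λ v → height v ≤ suc (toℕ k)) vs
highest-black {i = i} vs i∈vs
  with argmax height (black i) vs | argmax-sel height (black i) vs
     | f[⊥]≤f[argmax] {f = height} (black i) vs | f[xs]≤f[argmax] {f = height} (black i) vs
... | black k | inj₁ refl | _  | lower = k , i∈vs , lower
... | black k | inj₂ k∈vs | _  | lower = k , k∈vs , lower
... | white _ | _         | () | _

module _ {n : ℕ} {S : EdgeSet n} where

  adj-sym : ∀ {u v} → Adj S u v → Adj S v u
  adj-sym {black _} {white _} uv = uv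
  adj-sym {white _} {black _} uv = uv

  walk-++ : ∀ {u v w} → Walk S u v → Walk S v w → Walk S u w
  walk-++ here       vw = vw
  walk-++ (step a p) vw = step a (walk-++ p vw)

  walk-reverse : ∀ {u v} → Walk S u v → Walk S v u
  walk-reverse here       = here
  walk-reverse (step a p) = walk-++ (walk-reverse p) (step (adj-sym a) here)

  chain-suffix : ∀ xs {ys} → Chain S (xs ++ ys) → Chain S ys
  chain-suffix []           c       = c
  chain-suffix (x ∷ [])     {[]}    _       = tt
  chain-suffix (x ∷ [])     {y ∷ _} (_ , c) = c
  chain-suffix (x ∷ x′ ∷ xs) (_ , c) = chain-suffix (x′ ∷ xs) c

  chain-∷ʳ : ∀ xs {x y} → Chain S (xs ∷ʳ x) → Adj S x y → Chain S (xs ∷ʳ x ∷ʳ y)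
  chain-∷ʳ []            _       xy = xy , tt
  chain-∷ʳ (x′ ∷ [])     (a , _) xy = a , xy , tt
  chain-∷ʳ (x′ ∷ x″ ∷ xs) (a , c) xy = a , chain-∷ʳ (x″ ∷ xs) c xy

  cycle-rotate₁ : ∀ {v ws} → IsCycle S (v ∷ ws) → IsCycle S (ws ∷ʳ v)
  cycle-rotate₁ {v} {[]}     (s≤s () , _)
  cycle-rotate₁ {v} {w ∷ ws} (3≤len , v∉ws ∷ unique , v-w , closed) =
    subst (3 ≤_) (cong suc (sym (trans (length-++ ws) (+-comm (length ws) 1)))) 3≤len ,
    Unique.++⁺ unique ([] ∷ []) (λ { (v∈ws , here refl) → All.lookup v∉ws v∈ws refl }) ,
    chain-∷ʳ (w ∷ ws) closed v-w

  cycle-rotate : ∀ xs {v ys} → IsCycle S (xs ++ v ∷ ys) → IsCycle S (v ∷ ys ++ xs)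
  cycle-rotate []       {v} {ys} c = subst (λ l → IsCycle S (v ∷ l)) (sym (++-identityʳ ys)) c
  cycle-rotate (x ∷ xs) {v} {ys} c =
    subst (λ l → IsCycle S (v ∷ l)) (++-assoc ys [ x ] xs)
      (cycle-rotate xs (subst (IsCycle S) (++-assoc xs (v ∷ ys) [ x ]) (cycle-rotate₁ c)))

  cycle-has-black : ∀ {v vs} → IsCycle S (v ∷ vs) → ∃[ i ] black i ∈ˡ v ∷ vs
  cycle-has-black {black i}                 _                = i , here refl
  cycle-has-black {white _} {[]}            (s≤s () , _)
  cycle-has-black {white _} {black i ∷ _}   _                = i , there (here refl)
  cycle-has-black {white _} {white _ ∷ _}   (_ , _ , () , _)

  cycle-from-highest : ∀ {cs} → IsCycle S cs →
    ∃[ k ] ∃[ rest ] IsCycle S (black k ∷ rest) × All (λ v → height v ≤ suc (toℕ k)) rest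
  cycle-from-highest {v ∷ vs} c with highest-black (v ∷ vs) (proj₂ (cycle-has-black c))
  ... | k , k∈cs , lower with ∈-∃++ k∈cs
  ... | xs , ys , cs≡ =
    k , ys ++ xs , cycle-rotate xs (subst (IsCycle S) cs≡ c) ,
    All.tail (All-rotate xs (subst (All _) cs≡ lower))

-- The cycle runs k•, j∘, ia•, …, ic•, j′∘ and back to k•.
record Corner {n} (S : EdgeSet n) (k : Fin (suc n)) (rest : List (Vtx n)) : Set where
  field
    j j′ ia ic : Fin (suc n)
    j≢j′       : j ≢ j′
    k–j        : S k j ≡ true
    ia–j       : S ia j ≡ true
    ic–j′      : S ic j′ ≡ true
    k–j′       : S k j′ ≡ true
    ia∈rest    : black ia ∈ˡ rest
    ic∈rest    : black ic ∈ˡ rest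

module _ {n : ℕ} {S : EdgeSet n} {k : Fin (suc n)} where

  cycle-corner : ∀ {rest} → IsCycle S (black k ∷ rest) → Corner S k rest
  cycle-corner {rest} (3≤len , _ ∷ unique , closed) with last-two rest (s≤s⁻¹ 3≤len)
  ... | ps , _ , _ , refl =
    corner ps unique closed
      (chain-suffix (black k ∷ ps) (subst (λ l → Chain S (black k ∷ l)) (++-assoc ps _ [ black k ]) closed))
    where
    corner : ∀ ps {c w} → Unique (ps ++ c ∷ w ∷ []) →
             Chain S (black k ∷ (ps ++ c ∷ w ∷ []) ++ [ black k ]) → Chain S (c ∷ w ∷ black k ∷ []) →
             Corner S k (ps ++ c ∷ w ∷ [])
    corner _ {w = black _}             _ _ (_ , () , _)
    corner _ {white _} {white _}       _ _ (() , _)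
    corner [] {black _} {white _}      _ (() , _) _
    corner (black _ ∷ _)               _ (() , _) _
    corner (white _ ∷ white _ ∷ _)     _ (_ , () , _) _
    corner (white j ∷ []) {black ic} {white j′} (j∉ ∷ _) (k–j , ic–j , _) (ic–j′ , k–j′ , _) =
      record
      { j = j ; j′ = j′ ; ia = ic ; ic = ic
      ; j≢j′ = λ j≡j′ → All.lookup j∉ (there (here refl)) (cong white j≡j′)
      ; k–j = k–j ; ia–j = ic–j ; ic–j′ = ic–j′ ; k–j′ = k–j′
      ; ia∈rest = there (here refl) ; ic∈rest = there (here refl)
      }
    corner (white j ∷ black ia ∷ ps) {black ic} {white j′} (j∉ ∷ _) (k–j , ia–j , _) (ic–j′ , k–j′ , _) =
      record
      { j = j ; j′ = j′ ; ia = ia ; ic = ic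
      ; j≢j′ = λ j≡j′ → All.lookup j∉ (there (∈-++⁺ʳ ps (there (here refl)))) (cong white j≡j′)
      ; k–j = k–j ; ia–j = ia–j ; ic–j′ = ic–j′ ; k–j′ = k–j′
      ; ia∈rest = there (here refl) ; ic∈rest = ∈-++⁺ʳ (white j ∷ black ia ∷ ps) (here refl)
      }

insert : ∀ {n} → Fin (suc n) → Fin (suc n) → EdgeSet n → EdgeSet n
insert i j S a b = S a b ∨ (does (a ≟ i) ∧ does (b ≟ j))

module _ {n : ℕ} {i j : Fin (suc n)} {S : EdgeSet n} where

  ⊆E-insert : S ⊆E insert i j S
  ⊆E-insert a b Sab rewrite Sab = refl

  insert-new : insert i j S i j ≡ true
  insert-new rewrite dec-true (i ≟ i) refl | dec-true (j ≟ j) refl = Bool.∨-zeroʳ (S i j)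

  insert-cases : ∀ {a b} → insert i j S a b ≡ true → S a b ≡ true ⊎ (a ≡ i × b ≡ j)
  insert-cases {a} {b} ab with S a b | a ≟ i | b ≟ j
  ... | true  | _        | _        = inj₁ refl
  ... | false | yes refl | yes refl = inj₂ (refl , refl)
  ... | false | no _     | _        = contradiction ab λ ()
  ... | false | yes _    | no _     = contradiction ab λ ()

xpos-bound : ∀ n → suc (2 * n) + suc (2 * n) < 4 * n + 3
xpos-bound n = ≤-reflexive (equation n)
  where
  equation : ∀ n → suc (suc (2 * n) + suc (2 * n)) ≡ 4 * n + 3
  equation = solve-∀

module Polygon {n : ℕ} (ε : Fin n → Sign) where

  open BoundaryOrder (4 * n + 3) (suc (2 * n)) (xpos-bound n)

  xpos-≤ : ∀ (v : Vtx n) → xpos v ≤ suc (2 * n)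
  xpos-≤ (black i) = m≤n⇒m≤1+n (*-monoʳ-≤ 2 (toℕ≤pred[n] i))
  xpos-≤ (white j) = s≤s (*-monoʳ-≤ 2 (toℕ≤pred[n] j))

  xpos-injective : ∀ {v w : Vtx n} → xpos v ≡ xpos w → v ≡ w
  xpos-injective {black i} {black i′} eq = cong black (toℕ-injective (*-cancelˡ-≡ _ _ 2 eq))
  xpos-injective {black i} {white j}  eq = contradiction eq (even≢odd (toℕ i) (toℕ j))
  xpos-injective {white j} {black i}  eq = contradiction (sym eq) (even≢odd (toℕ i) (toℕ j))
  xpos-injective {white j} {white j′} eq = cong white (toℕ-injective (*-cancelˡ-≡ _ _ 2 (suc-injective eq)))

  cyc-injective : ∀ {v w} → cyc ε v ≡ cyc ε w → v ≡ w
  cyc-injective {v} {w} eq = xpos-injective (fold-injective (xpos-≤ v) (xpos-≤ w) eq)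

  black≢white : ∀ i j → cyc ε (black i) ≢ cyc ε (white j)
  black≢white i j eq with cyc-injective {black i} {white j} eq
  ... | ()

  cyc-black-injective : ∀ {i i′} → cyc ε (black i) ≡ cyc ε (black i′) → i ≡ i′
  cyc-black-injective {i} {i′} eq with cyc-injective {black i} {black i′} eq
  ... | refl = refl

  cyc-white-injective : ∀ {j j′} → cyc ε (white j) ≡ cyc ε (white j′) → j ≡ j′
  cyc-white-injective {j} {j′} eq with cyc-injective {white j} {white j′} eq
  ... | refl = refl

  black<white : ∀ {i j : Fin (suc n)} → toℕ i ≤ toℕ j → xpos (black i) < xpos (white j)
  black<white i≤j = s≤s (*-monoʳ-≤ 2 i≤j)

  white<black : ∀ {i j : Fin (suc n)} → toℕ j < toℕ i → xpos (white j) < xpos (black i)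
  white<black {i} {j} j<i = subst (_≤ 2 * toℕ i) (*-suc 2 (toℕ j)) (*-monoʳ-≤ 2 j<i)

  black<black : ∀ {i i′ : Fin (suc n)} → toℕ i < toℕ i′ → xpos (black i) < xpos (black i′)
  black<black = *-monoʳ-< 2

  white<white : ∀ {j j′ : Fin (suc n)} → toℕ j < toℕ j′ → xpos (white j) < xpos (white j′)
  white<white = s≤s ∘ *-monoʳ-< 2

  private
    Crossingᶜ : (i j i′ j′ : Fin (suc n)) → Set
    Crossingᶜ i j i′ j′ =
      Crossing (cyc ε (black i)) (cyc ε (white j)) (cyc ε (black i′)) (cyc ε (white j′))

    Cross⇒Crossing : ∀ {i j i′ j′} → Cross ε i j i′ j′ → Crossingᶜ i j i′ j′
    Cross⇒Crossing (i≢i′ , j≢j′ , separated) =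
      i≢i′ ∘ cyc-black-injective , j≢j′ ∘ cyc-white-injective , separated

    Crossing⇒Cross : ∀ {i j i′ j′} → Crossingᶜ i j i′ j′ → Cross ε i j i′ j′
    Crossing⇒Cross (i≢i′ , j≢j′ , separated) =
      i≢i′ ∘ cong (cyc ε ∘ black) , j≢j′ ∘ cong (cyc ε ∘ white) , separated

  cross-sym : ∀ {i j i′ j′} → Cross ε i j i′ j′ → Cross ε i′ j′ i j
  cross-sym {i} {j} {i′} {j′} =
    Crossing⇒Cross ∘ crossing-sym (black≢white i j′) (black≢white i′ j) ∘ Cross⇒Crossing

  cross-swap-white : ∀ {i j a b a′ b′} →
    Cross ε i j a b → Cross ε i b a′ b′ → ¬ Cross ε a b a′ b′ → Cross ε i j a′ b′
  cross-swap-white {i} {j} {a} {b} {a′} {b′} X Y ¬Z =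
    Crossing⇒Cross (crossing-swap-white (black≢white i b′) (black≢white a b′) (black≢white a′ b)
                                 (Cross⇒Crossing X) (Cross⇒Crossing Y) (¬Z ∘ Crossing⇒Cross))

  cross-swap-black : ∀ {i j a b a′ b′} →
    Cross ε i j a b → Cross ε a j a′ b′ → ¬ Cross ε a b a′ b′ → Cross ε i j a′ b′
  cross-swap-black {i} {j} {a} {b} {a′} {b′} X Y ¬Z =
    Crossing⇒Cross (crossing-swap-black (black≢white a b′) (black≢white a′ j) (black≢white a′ b)
                                 (Cross⇒Crossing X) (Cross⇒Crossing Y) (¬Z ∘ Crossing⇒Cross))

  cyc-between-middle : ∀ {p q z : Vtx n} → xpos p < xpos z → xpos z < xpos q →
    does (between? (cyc ε p) (cyc ε q) (cyc ε z)) ≡ not (above ε p xor above ε z)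
  cyc-between-middle {p} {q} {z} p<z z<q = between-middle {above ε p} {above ε q} {above ε z} p<z z<q (xpos-≤ q)

  cyc-between-right : ∀ {p q z : Vtx n} → xpos p < xpos q → xpos q < xpos z →
    does (between? (cyc ε p) (cyc ε q) (cyc ε z)) ≡ above ε p xor above ε q
  cyc-between-right {p} {q} {z} p<q q<z = between-right {above ε p} {above ε q} {above ε z} p<q q<z (xpos-≤ z)

  cyc-between-left : ∀ {p q z : Vtx n} → xpos z < xpos p → xpos p < xpos q →
    does (between? (cyc ε p) (cyc ε q) (cyc ε z)) ≡ false
  cyc-between-left {p} {q} {z} z<p p<q = between-left {above ε p} {above ε q} {above ε z} z<p p<q (xpos-≤ q)

  ¬separates-right : ∀ {p q r s : Vtx n} → xpos p < xpos q → xpos q < xpos r → xpos q < xpos s →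
    ¬ Separates (cyc ε p) (cyc ε q) (cyc ε r) (cyc ε s)
  ¬separates-right {p} {q} {r} {s} p<q q<r q<s = same-side⇒¬separates
    (trans (cyc-between-right {p} {q} {r} p<q q<r) (sym (cyc-between-right {p} {q} {s} p<q q<s)))

  ¬separates-left : ∀ {p q r s : Vtx n} → xpos r < xpos p → xpos s < xpos p → xpos p < xpos q →
    ¬ Separates (cyc ε p) (cyc ε q) (cyc ε r) (cyc ε s)
  ¬separates-left {p} {q} {r} {s} r<p s<p p<q = same-side⇒¬separates
    (trans (cyc-between-left {p} {q} {r} r<p p<q) (sym (cyc-between-left {p} {q} {s} s<p p<q)))

  crossing-edges-overlap : ∀ {i j i′ j′ : Fin (suc n)} → toℕ i ≤ toℕ j → toℕ i′ ≤ toℕ j′ →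
                           Cross ε i j i′ j′ → toℕ i′ ≤ toℕ j × toℕ i ≤ toℕ j′
  crossing-edges-overlap {i} {j} {i′} {j′} i≤j i′≤j′ (_ , _ , separated) =
    ≮⇒≥ (λ j<i′ → ¬separates-right {black i} {white j} {black i′} {white j′}
                    (black<white i≤j) (white<black j<i′) (white<white (<-≤-trans j<i′ i′≤j′))
                    separated) ,
    ≮⇒≥ (λ j′<i → ¬separates-left {black i} {white j} {black i′} {white j′}
                    (black<black (≤-<-trans i′≤j′ j′<i)) (white<black j′<i) (black<white i≤j) separated)

  -- If k and j lie on the same side of the line, the chord (ia, j) separates k from j′;
  -- otherwise the chord (ic, j′) separates k from j.
  corner-cross : ∀ {ia ic k j j′ : Fin (suc n)} →
    toℕ ia < toℕ k → toℕ ic < toℕ k → toℕ k ≤ toℕ j → toℕ j < toℕ j′ →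
    Cross ε ia j k j′ ⊎ Cross ε ic j′ k j
  corner-cross {ia} {ic} {k} {j} {j′} ia<k ic<k k≤j j<j′
    with above ε (black k) Bool.≟ above ε (white j)
  ... | yes same = inj₁ (Fin.<⇒≢ ia<k , Fin.<⇒≢ j<j′ , opposite-sides⇒separates (begin
    does (between? (cyc ε (black ia)) (cyc ε (white j)) (cyc ε (black k)))
      ≡⟨ cyc-between-middle {black ia} {white j} {black k} (black<black ia<k) (black<white k≤j) ⟩
    not (above ε (black ia) xor above ε (black k))
      ≡⟨ cong (λ side → not (above ε (black ia) xor side)) same ⟩
    not (above ε (black ia) xor above ε (white j))
      ≡⟨ cong not (sym (cyc-between-right {black ia} {white j} {white j′}
                         (black<white (<⇒≤ (<-≤-trans ia<k k≤j))) (white<white j<j′))) ⟩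
    not (does (between? (cyc ε (black ia)) (cyc ε (white j)) (cyc ε (white j′)))) ∎))
    where open ≡-Reasoning
  ... | no differ = inj₂ (Fin.<⇒≢ ic<k , Fin.<⇒≢ j<j′ ∘ sym , opposite-sides⇒separates (begin
    does (between? (cyc ε (black ic)) (cyc ε (white j′)) (cyc ε (black k)))
      ≡⟨ cyc-between-middle {black ic} {white j′} {black k} (black<black ic<k) (black<white k≤j′) ⟩
    not (above ε (black ic) xor above ε (black k))
      ≡⟨ Bool.not-distribʳ-xor (above ε (black ic)) (above ε (black k)) ⟩
    above ε (black ic) xor not (above ε (black k))
      ≡⟨ cong (above ε (black ic) xor_) (sym (Bool.¬-not (differ ∘ sym))) ⟩
    above ε (black ic) xor above ε (white j)
      ≡⟨ sym (Bool.not-involutive _) ⟩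
    not (not (above ε (black ic) xor above ε (white j)))
      ≡⟨ cong not (sym (cyc-between-middle {black ic} {white j′} {white j}
                         (black<white (<⇒≤ (<-≤-trans ic<k k≤j))) (white<white j<j′))) ⟩
    not (does (between? (cyc ε (black ic)) (cyc ε (white j′)) (cyc ε (white j)))) ∎))
    where
    open ≡-Reasoning
    k≤j′ : toℕ k ≤ toℕ j′
    k≤j′ = ≤-trans k≤j (<⇒≤ j<j′)

  cross? : ∀ i j i′ j′ → Dec (Cross ε i j i′ j′)
  cross? i j i′ j′ = ¬? (i ≟ i′) ×-dec ¬? (j ≟ j′) ×-dec separates? _ _ _ _

  crossing-edges-recombine : ∀ {I J i j a b} → IsEdge I J i j → IsEdge I J a b → Cross ε i j a b →
                             IsEdge I J i b × IsEdge I J a j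
  crossing-edges-recombine (i∈I , j∈J , i<j) (a∈I , b∈J , a<b) X =
    let (a≤j , i≤b) = crossing-edges-overlap (s≤s⁻¹ i<j) (s≤s⁻¹ a<b) X
    in (i∈I , b∈J , s≤s i≤b) , (a∈I , j∈J , s≤s a≤j)

  insert-nonCrossing : ∀ {S i j} → NonCrossing ε S → (∀ a b → S a b ≡ true → ¬ Cross ε i j a b) →
                       NonCrossing ε (insert i j S)
  insert-nonCrossing {S} nc free a b a′ b′ ab a′b′
    with insert-cases {S = S} ab | insert-cases {S = S} a′b′
  ... | inj₁ Sab           | inj₁ Sa′b′         = nc a b a′ b′ Sab Sa′b′
  ... | inj₂ (refl , refl) | inj₁ Sa′b′         = free a′ b′ Sa′b′
  ... | inj₁ Sab           | inj₂ (refl , refl) = free a b Sab ∘ cross-sym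
  ... | inj₂ (refl , refl) | inj₂ (refl , refl) = λ X → proj₁ X refl

  CrossingEdge : EdgeSet n → Fin (suc n) → Fin (suc n) → Fin (suc n) × Fin (suc n) → Set
  CrossingEdge S i j = uncurry λ a b → S a b ≡ true × Cross ε i j a b

  crossingEdge? : ∀ S i j → Decidable (CrossingEdge S i j)
  crossingEdge? S i j (a , b) = (S a b Bool.≟ true) ×-dec cross? i j a b

  crossings : EdgeSet n → Fin (suc n) → Fin (suc n) → ℕ
  crossings S i j = count (crossingEdge? S i j) (allPairs (allFin _) (allFin _))

  crossings-< : ∀ {S i j i′ j′ a b} →
    (∀ {a′ b′} → S a′ b′ ≡ true → Cross ε i′ j′ a′ b′ → Cross ε i j a′ b′) →
    S a b ≡ true → Cross ε i j a b → ¬ Cross ε i′ j′ a b → crossings S i′ j′ < crossings S i j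
  crossings-< {S} {i} {j} {i′} {j′} inherited Sab X ¬X′ =
    count-strict (crossingEdge? S i′ j′) (crossingEdge? S i j)
                 (λ (Sa′b′ , X′) → Sa′b′ , inherited Sa′b′ X′)
                 (∈-allPairs⁺ (∈-allFin⁺ _) (∈-allFin⁺ _)) (¬X′ ∘ proj₂) (Sab , X)

module Connectivity {n} {ε : Fin n → Sign} {I J : Subset (suc n)} {S : EdgeSet n}
                    (S-maximal : MaximalNonCrossing ε I J S) where

  open Polygon ε

  private
    S⊆G : EdgesOf I J S
    S⊆G = proj₁ S-maximal

    S-nc : NonCrossing ε S
    S-nc = proj₁ (proj₂ S-maximal)

    S-max : ∀ T → EdgesOf I J T → NonCrossing ε T → S ⊆E T → T ⊆E S
    S-max = proj₂ (proj₂ S-maximal)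

  missing-edge-crossed : ∀ {i j} → IsEdge I J i j → S i j ≡ false →
                         ∃[ a ] ∃[ b ] S a b ≡ true × Cross ε i j a b
  missing-edge-crossed {i} {j} e Sij≡false with any? (λ a → any? (λ b → crossingEdge? S i j (a , b)))
  ... | yes (a , b , Sab , X) = a , b , Sab , X
  ... | no uncrossed = contradiction (trans (sym Sij≡false) Sij≡true) λ ()
    where
    T⊆G : EdgesOf I J (insert i j S)
    T⊆G a b Tab with insert-cases {S = S} Tab
    ... | inj₁ Sab           = S⊆G a b Sab
    ... | inj₂ (refl , refl) = e
    Sij≡true : S i j ≡ true
    Sij≡true = S-max (insert i j S) T⊆G
      (insert-nonCrossing S-nc λ a b Sab X → uncrossed (a , b , Sab , X)) ⊆E-insert i j (insert-new {S = S})

  edge-walk : ∀ {i j} → IsEdge I J i j → Walk S (black i) (white j)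
  edge-walk e = walk e (<-wellFounded _)
    where
    walk : ∀ {i j} → IsEdge I J i j → Acc _<_ (crossings S i j) → Walk S (black i) (white j)
    walk {i} {j} ij (acc smaller) with S i j in Sij
    ... | true  = step Sij here
    ... | false with missing-edge-crossed ij Sij
    ... | a , b , Sab , X =
      walk-++ (walk (proj₁ recombined) (smaller fewer-ib)) (step Sab (walk (proj₂ recombined) (smaller fewer-aj)))
      where
      recombined : IsEdge I J i b × IsEdge I J a j
      recombined = crossing-edges-recombine ij (S⊆G a b Sab) X

      fewer-ib : crossings S i b < crossings S i j
      fewer-ib = crossings-< (λ Sa′b′ Y → cross-swap-white X Y (S-nc a b _ _ Sab Sa′b′))
                             Sab X (λ Y → proj₁ (proj₂ Y) refl)

      fewer-aj : crossings S a j < crossings S i j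
      fewer-aj = crossings-< (λ Sa′b′ Y → cross-swap-black X Y (S-nc a b _ _ Sab Sa′b′))
                             Sab X (λ Y → proj₁ Y refl)

  connected : (∃[ i ] (i ∈ I × (∀ j → j ∈ J → blackIdx i < whiteIdx j))) →
              (∃[ j ] (j ∈ J × (∀ i → i ∈ I → blackIdx i < whiteIdx j))) →
              ∀ u v → InV I J u → InV I J v → Walk S u v
  connected (i₀ , i₀∈I , i₀<J) (j₀ , j₀∈J , I<j₀) u v u∈ v∈ =
    walk-++ (to-j₀ u u∈) (walk-reverse (to-j₀ v v∈))
    where
    to-j₀ : ∀ u → InV I J u → Walk S u (white j₀)
    to-j₀ (black i) i∈I = edge-walk (i∈I , j₀∈J , I<j₀ i i∈I)
    to-j₀ (white j) j∈J = walk-++ (walk-reverse (edge-walk (i₀∈I , j∈J , i₀<J j j∈J)))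
                                  (edge-walk (i₀∈I , j₀∈J , i₀<J j₀ j₀∈J))

module Acyclicity {n} {ε : Fin n → Sign} {I J : Subset (suc n)} {S : EdgeSet n}
                  (S⊆G : EdgesOf I J S) (S-nc : NonCrossing ε S) where

  open Polygon ε

  no-cycle-from-highest : ∀ {k rest} → IsCycle S (black k ∷ rest) →
                          All (λ v → height v ≤ suc (toℕ k)) rest → ⊥
  no-cycle-from-highest {k} {rest} c@(_ , k∉rest ∷ _ , _) lower = by-order (<-cmp (toℕ j) (toℕ j′))
    where
    open Corner (cycle-corner c)

    lower-black : ∀ {i} → black i ∈ˡ rest → toℕ i < toℕ k
    lower-black i∈rest =
      ≤∧≢⇒< (s≤s⁻¹ (All.lookup lower i∈rest))
            (λ i≡k → All.lookup k∉rest i∈rest (cong black (sym (toℕ-injective i≡k))))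

    k≤j : toℕ k ≤ toℕ j
    k≤j = s≤s⁻¹ (proj₂ (proj₂ (S⊆G k j k–j)))

    k≤j′ : toℕ k ≤ toℕ j′
    k≤j′ = s≤s⁻¹ (proj₂ (proj₂ (S⊆G k j′ k–j′)))

    by-order : Tri (toℕ j < toℕ j′) (toℕ j ≡ toℕ j′) (toℕ j′ < toℕ j) → ⊥
    by-order (tri< j<j′ _ _) =
      [ S-nc ia j k j′ ia–j k–j′ , S-nc ic j′ k j ic–j′ k–j ]′
        (corner-cross (lower-black ia∈rest) (lower-black ic∈rest) k≤j j<j′)
    by-order (tri≈ _ j≡j′ _) = j≢j′ (toℕ-injective j≡j′)
    by-order (tri> _ _ j′<j) =
      [ S-nc ic j′ k j ic–j′ k–j , S-nc ia j k j′ ia–j k–j′ ]′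
        (corner-cross (lower-black ic∈rest) (lower-black ia∈rest) k≤j′ j′<j)

  acyclic : ∀ cs → ¬ IsCycle S cs
  acyclic cs c with cycle-from-highest c
  ... | k , rest , c′ , lower = no-cycle-from-highest c′ lower

proposition1p1 : (n : ℕ) → 1 ≤ n → (ε : Fin n → Sign) →
    (I J : Subset (suc n)) →
    -- min(I•) < min(J∘)  (in particular I• is nonempty)
    (∃[ i ] (i ∈ I × (∀ j → j ∈ J → blackIdx i < whiteIdx j))) →
    -- max(I•) < max(J∘)  (in particular J∘ is nonempty)
    (∃[ j ] (j ∈ J × (∀ i → i ∈ I → blackIdx i < whiteIdx j))) →
    (S : EdgeSet n) → MaximalNonCrossing ε I J S → IsSpanningTree I J S
proposition1p1 n _ ε I J min-condition max-condition S S-maximal@(S⊆G , S-nc , _) =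
  S⊆G ,
  Connectivity.connected S-maximal min-condition max-condition ,
  Acyclicity.acyclic S⊆G S-nc
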